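{- For every integer $k \ge 1$, there exists a tree $T$ such that $F_t(T) = F(T) + k$.
   Context: Forcing process: given a graph $G$ and an initial set $S \subseteq V(G)$ of colored vertices, at each step a colored vertex that has exactly one non-colored neighbor forces (colors) that neighbor. $S$ is a forcing set if iterating this eventually colors all of $V(G)$; $F(G)$ is the minimum cardinality of a forcing set. A total forcing set (TF-set) is a forcing set $S$ such that $G[S]$ has no isolated vertex; $F_t(G)$ is the minimum cardinality of a TF-set. -}

module Defs where

open import Data.Nat using (ℕ; zero; suc; _+_; _≤_)
open import Data.Fin using (Fin; zero; suc; inject₁; fromℕ)
open import Data.Fin.Subset using (Subset; _∈_; ∣_∣)
open import Data.Bool using (Bool; true; false)
open import Data.Product using (Σ; ∃; _×_; _,_)
open import Relation.Binary.PropositionalEquality using (_≡_; _≢_)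
open import Relation.Nullary using (¬_)
open import Function.Definitions using (Injective)

record Graph : Set where
  field
    n      : ℕ
    adj    : Fin n → Fin n → Bool
    adj-sym    : ∀ u v → adj u v ≡ adj v u
    adj-irrefl : ∀ v → adj v v ≡ false

open Graph public

Vertex : Graph → Set
Vertex G = Fin (n G)

Adj : (G : Graph) → Vertex G → Vertex G → Set
Adj G u v = adj G u v ≡ true

data Walk (G : Graph) : Vertex G → Vertex G → Set where
  here : ∀ {v} → Walk G v v
  step : ∀ {u w v} → Adj G u w → Walk G w v → Walk G u v

Connected : Graph → Set
Connected G = ∀ u v → Walk G u v

record Cycle (G : Graph) : Set where
  field
    m     : ℕ
    c     : Fin (suc (suc (suc m))) → Vertex G
    c-inj : Injective _≡_ _≡_ c
    c-adj : ∀ (i : Fin (suc (suc m))) → Adj G (c (inject₁ i)) (c (suc i))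
    c-close : Adj G (c (fromℕ (suc (suc m)))) (c zero)

IsTree : Graph → Set
IsTree G = (1 ≤ n G) × Connected G × ¬ Cycle G

-- Vertices colored by the forcing process started from S: the least set
-- containing S and closed under the rule "a colored vertex u all of whose
-- neighbours other than v are colored forces its neighbour v".
data Colored (G : Graph) (S : Subset (n G)) : Vertex G → Set where
  initial : ∀ {v} → v ∈ S → Colored G S v
  force   : ∀ {u v} → Colored G S u → Adj G u v →
            (∀ w → Adj G u w → w ≢ v → Colored G S w) →
            Colored G S v

IsForcingSet : (G : Graph) → Subset (n G) → Set
IsForcingSet G S = ∀ v → Colored G S v

NoIsolatedIn : (G : Graph) → Subset (n G) → Set
NoIsolatedIn G S = ∀ v → v ∈ S → ∃ λ w → w ∈ S × Adj G v w

IsTotalForcingSet : (G : Graph) → Subset (n G) → Set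
IsTotalForcingSet G S = IsForcingSet G S × NoIsolatedIn G S

IsMinCard : (G : Graph) → (Subset (n G) → Set) → ℕ → Set
IsMinCard G P k = (∃ λ S → P S × ∣ S ∣ ≡ k) × (∀ S → P S → k ≤ ∣ S ∣)

ForcingNumber : Graph → ℕ → Set
ForcingNumber G k = IsMinCard G (IsForcingSet G) k

TotalForcingNumber : Graph → ℕ → Set
TotalForcingNumber G k = IsMinCard G (IsTotalForcingSet G) k

module Submission where

open import Defs
open import Data.Nat using (ℕ; _+_; _≤_)
open import Data.Product using (Σ; ∃; _×_; _,_)
open import Relation.Binary.PropositionalEquality using (_≡_)

-- For k = j + 1 ≥ 1 the witness is the caterpillar whose spine is a path
-- x₀ x₁ … x_j, every spine vertex carrying two pendant leaves.
--
-- Forcing number k: every forcing set meets each pair of twin leaves, since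
-- the only vertex able to force one of them is their common neighbour, and it
-- cannot do so while the other twin is uncolored; conversely the k first
-- leaves force everything.  Total forcing number 2k: a total forcing set
-- contains a leaf of every pair, hence, having no isolated vertex, also the
-- neighbour of that leaf; conversely the k spine vertices with their first
-- leaves form a total forcing set.

open import Data.Nat as ℕ using (zero; suc; _*_; _∸_; _<_; z≤n; s≤s; _<?_; _≟_)
open import Data.Nat.Properties
  using (≤-trans; <-trans; <-irrefl; <⇒≱; ≤∧≢⇒<; ≤-refl; +-mono-≤; m≤n+m; m<n⇒m<1+n;
         +-∸-assoc; +-identityʳ; n<1+n; +-comm; *-comm; *-suc; _≤?_; ≰⇒>; <⇒≤)
open import Data.Nat.DivMod using (_/_; m/n*n≤m; m*n/n≡m; m<n⇒m/n≡0; +-distrib-/-∣ˡ)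
open import Data.Nat.Divisibility using (_∣_; n∣m*n; m∣m*n; ∣m+n∣m⇒∣n; ∣⇒≤)
open import Data.Fin as Fin using (Fin; toℕ; fromℕ; fromℕ<; inject₁; combine; remQuot)
open import Data.Fin.Properties
  using (toℕ-injective; toℕ-fromℕ<; toℕ<n; toℕ-inject₁; toℕ-combine; combine-remQuot;
         combine-injectiveˡ; combine-injectiveʳ)
open import Data.Fin.Induction using (<-wellFounded)
open import Data.Fin.Subset using (Subset; _∈_; _∉_; ∣_∣; inside; outside)
open import Data.Fin.Subset.Properties using (_∈?_; x∈p⇒∣p-x∣<∣p∣; x∈p∧x≢y⇒x∈p-y)
open import Data.Vec
  using (Vec; []; _∷_; here; there; _++_; lookup; tabulate; concat; replicate; group)
open import Data.Vec.Properties
  using (lookup-concat; lookup∘tabulate; tabulate∘lookup; tabulate-cong; lookup-replicate;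
         []=⇒lookup; lookup⇒[]=)
open import Data.Bool using (true)
open import Data.Empty using (⊥-elim)
open import Data.Sum using (_⊎_; inj₁; inj₂; swap)
open import Data.Product using (proj₁; proj₂)
open import Function using (_∘_)
open import Induction.WellFounded using (module All)
open import Level using (0ℓ)
open import Relation.Binary.PropositionalEquality
  using (refl; sym; trans; cong; cong₂; subst; _≢_; module ≡-Reasoning)
open import Relation.Nullary using (¬_; Dec; yes; no; does; contradiction)
open import Relation.Nullary.Decidable using (_×-dec_; _⊎-dec_; dec-true; dec-false)

adj-sym′ : (G : Graph) {u v : Vertex G} → Adj G u v → Adj G v u
adj-sym′ G {u} {v} a = trans (adj-sym G v u) a

adj⇒≢ : (G : Graph) {u v : Vertex G} → Adj G u v → u ≢ v
adj⇒≢ G {u} a refl with trans (sym a) (adj-irrefl G u)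
... | ()

_++ʷ_ : {G : Graph} {u v w : Vertex G} → Walk G u v → Walk G v w → Walk G u w
here     ++ʷ q = q
step a p ++ʷ q = step a (p ++ʷ q)

reverseʷ : {G : Graph} {u v : Vertex G} → Walk G u v → Walk G v u
reverseʷ         here       = here
reverseʷ {G = G} (step a p) = reverseʷ p ++ʷ step (adj-sym′ G a) here

record Pendant (G : Graph) (u x : Vertex G) : Set where
  field
    attached : Adj G u x
    only     : ∀ w → Adj G u w → w ≡ x

open Pendant

module _ {G : Graph} {S : Subset (n G)} where

  pendant-forces : ∀ {u x} → Pendant G u x → Colored G S u → Colored G S x
  pendant-forces p cu = force cu (attached p) (λ w a w≢x → contradiction (only p w a) w≢x)

  -- Two uncolored twin pendants at x stay uncolored for ever: only x could
  -- force one of them, and x first needs the other one colored.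
  twins-stay-uncolored : ∀ {u u′ x} → Pendant G u x → Pendant G u′ x → u ≢ u′ →
                         u ∉ S → u′ ∉ S → ∀ {v} → Colored G S v → v ≢ u × v ≢ u′
  twins-stay-uncolored p p′ u≢u′ u∉S u′∉S (initial v∈S) =
    (λ { refl → u∉S v∈S }) , (λ { refl → u′∉S v∈S })
  twins-stay-uncolored {u} {u′} p p′ u≢u′ u∉S u′∉S (force {w} _ w~v others) = v≢u , v≢u′
    where
    v≢u : _ ≢ u
    v≢u refl with only p w (adj-sym′ G w~v)
    ... | refl = proj₂ (twins-stay-uncolored p p′ u≢u′ u∉S u′∉S
                          (others u′ (adj-sym′ G (attached p′)) (u≢u′ ∘ sym))) refl
    v≢u′ : _ ≢ u′
    v≢u′ refl with only p′ w (adj-sym′ G w~v)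
    ... | refl = proj₁ (twins-stay-uncolored p p′ u≢u′ u∉S u′∉S
                          (others u (adj-sym′ G (attached p)) u≢u′)) refl

  twin-pendants-meet : ∀ {u u′ x} → Pendant G u x → Pendant G u′ x → u ≢ u′ →
                       IsForcingSet G S → u ∈ S ⊎ u′ ∈ S
  twin-pendants-meet {u} {u′} p p′ u≢u′ forcing with u ∈? S | u′ ∈? S
  ... | yes u∈S | _       = inj₁ u∈S
  ... | no _    | yes u′∈S = inj₂ u′∈S
  ... | no u∉S  | no u′∉S  =
    ⊥-elim (proj₁ (twins-stay-uncolored p p′ u≢u′ u∉S u′∉S (forcing u)) refl)

  pendant-in-total : ∀ {u x} → Pendant G u x → NoIsolatedIn G S → u ∈ S → x ∈ S
  pendant-in-total p no-isolated u∈S with no-isolated _ u∈S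
  ... | w , w∈S , u~w = subst (_∈ S) (only p w u~w) w∈S

argmax : ∀ {N} (f : Fin (suc N) → ℕ) → ∃ λ j → ∀ i → f i ≤ f j
argmax {zero}  f = Fin.zero , λ { Fin.zero → ≤-refl }
argmax {suc N} f with argmax (f ∘ Fin.suc)
... | j , max-j with f Fin.zero ≤? f (Fin.suc j)
...   | yes f0≤ = Fin.suc j , λ { Fin.zero → f0≤ ; (Fin.suc i) → max-j i }
...   | no  f0≰ = Fin.zero ,
                  λ { Fin.zero → ≤-refl ; (Fin.suc i) → ≤-trans (max-j i) (<⇒≤ (≰⇒> f0≰)) }

last-or-inject₁ : ∀ {n} (j : Fin (suc n)) → j ≡ fromℕ n ⊎ ∃ λ i → j ≡ inject₁ i
last-or-inject₁ {zero}  Fin.zero    = inj₁ refl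
last-or-inject₁ {suc n} Fin.zero    = inj₂ (Fin.zero , refl)
last-or-inject₁ {suc n} (Fin.suc j) with last-or-inject₁ j
... | inj₁ j≡last   = inj₁ (cong Fin.suc j≡last)
... | inj₂ (i , j≡i) = inj₂ (Fin.suc i , cong Fin.suc j≡i)

module _ (G : Graph) (C : Cycle G) where
  open Cycle C

  cycle-neighbours : ∀ j → ∃ λ a → ∃ λ b → a ≢ b × Adj G (c j) (c a) × Adj G (c j) (c b)
  cycle-neighbours Fin.zero =
    Fin.suc Fin.zero , fromℕ (suc (suc m)) , (λ ()) , c-adj Fin.zero , adj-sym′ G c-close
  cycle-neighbours (Fin.suc j) with last-or-inject₁ j
  ... | inj₁ refl = inject₁ (fromℕ (suc m)) , Fin.zero , (λ ()) ,
                    adj-sym′ G (c-adj (fromℕ (suc m))) , c-close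
  ... | inj₂ (i , refl) = inject₁ (inject₁ i) , Fin.suc (Fin.suc i) , far-apart ,
                          adj-sym′ G (c-adj (inject₁ i)) , c-adj (Fin.suc i)
    where
    far-apart : inject₁ (inject₁ i) ≢ Fin.suc (Fin.suc i)
    far-apart e = <-irrefl (trans (sym (trans (toℕ-inject₁ (inject₁ i)) (toℕ-inject₁ i)))
                                  (cong toℕ e))
                           (m<n⇒m<1+n (n<1+n (toℕ i)))

-- Trees presented by a parent function: vertex t > 0 is joined to parent t < t.
-- Such a graph is a tree, and a vertex that is nobody's parent is a pendant.
module ParentTree (parent : ℕ → ℕ) (parent-< : ∀ t → parent (suc t) < suc t) where

  ChildOf : ℕ → ℕ → Set
  ChildOf t s = 0 < t × parent t ≡ s

  Linked : ℕ → ℕ → Set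
  Linked t s = ChildOf t s ⊎ ChildOf s t

  child⇒< : ∀ {t s} → ChildOf t s → s < t
  child⇒< {suc t} (_ , refl) = parent-< t

  linked? : ∀ t s → Dec (Linked t s)
  linked? t s = (0 <? t ×-dec parent t ≟ s) ⊎-dec (0 <? s ×-dec parent s ≟ t)

  linked-irrefl : ∀ t → ¬ Linked t t
  linked-irrefl t (inj₁ t-child-t) = <-irrefl refl (child⇒< t-child-t)
  linked-irrefl t (inj₂ t-child-t) = <-irrefl refl (child⇒< t-child-t)

  linked-sym : ∀ t s → does (linked? t s) ≡ does (linked? s t)
  linked-sym t s with linked? t s
  ... | yes l = trans (dec-true (linked? t s) l) (sym (dec-true (linked? s t) (swap l)))
  ... | no ¬l = trans (dec-false (linked? t s) ¬l) (sym (dec-false (linked? s t) (¬l ∘ swap)))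

  parentGraph : ℕ → Graph
  parentGraph m = record
    { n          = suc m
    ; adj        = λ u v → does (linked? (toℕ u) (toℕ v))
    ; adj-sym    = λ u v → linked-sym (toℕ u) (toℕ v)
    ; adj-irrefl = λ v → dec-false (linked? (toℕ v) (toℕ v)) (linked-irrefl (toℕ v))
    }

  module _ (m : ℕ) where

    private
      G : Graph
      G = parentGraph m

    adj⇒linked : ∀ {u v : Vertex G} → Adj G u v → Linked (toℕ u) (toℕ v)
    adj⇒linked {u} {v} = witness (linked? (toℕ u) (toℕ v))
      where
      witness : ∀ {A : Set} (a? : Dec A) → does a? ≡ true → A
      witness (yes a) _  = a
      witness (no _)  ()

    linked⇒adj : ∀ {u v : Vertex G} → Linked (toℕ u) (toℕ v) → Adj G u v
    linked⇒adj {u} {v} = dec-true (linked? (toℕ u) (toℕ v))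

    smaller-neighbour-is-parent : ∀ {u v : Vertex G} → Adj G u v → toℕ v < toℕ u →
                                  parent (toℕ u) ≡ toℕ v
    smaller-neighbour-is-parent u~v v<u with adj⇒linked u~v
    ... | inj₁ (_ , p≡v) = p≡v
    ... | inj₂ v-child-u = contradiction (<-trans v<u (child⇒< v-child-u)) (<-irrefl refl)

    childless-pendant : (u x : Vertex G) → 0 < toℕ u → parent (toℕ u) ≡ toℕ x →
                        (∀ t → 0 < t → parent t ≢ toℕ u) → Pendant G u x
    childless-pendant u x 0<u p≡x childless = record
      { attached = linked⇒adj (inj₁ (0<u , p≡x))
      ; only     = neighbour
      }
      where
      neighbour : ∀ w → Adj G u w → w ≡ x
      neighbour w u~w with adj⇒linked u~w
      ... | inj₁ (_ , p≡w)   = toℕ-injective (trans (sym p≡w) p≡x)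
      ... | inj₂ (0<w , p≡u) = contradiction p≡u (childless (toℕ w) 0<w)

    walk-to-root : ∀ v → Walk G v Fin.zero
    walk-to-root = All.wfRec <-wellFounded 0ℓ (λ v → Walk G v Fin.zero) climb
      where
      climb : ∀ v → (∀ {w} → w Fin.< v → Walk G w Fin.zero) → Walk G v Fin.zero
      climb Fin.zero    _   = here
      climb (Fin.suc v) rec = step (linked⇒adj (inj₁ (s≤s z≤n , sym up-label))) (rec up<v)
        where
        p<n : parent (suc (toℕ v)) < suc m
        p<n = <-trans (parent-< (toℕ v)) (toℕ<n (Fin.suc v))
        up-label : toℕ (fromℕ< p<n) ≡ parent (suc (toℕ v))
        up-label = toℕ-fromℕ< p<n
        up<v : fromℕ< p<n Fin.< Fin.suc v
        up<v = subst (_< suc (toℕ v)) (sym up-label) (parent-< (toℕ v))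

    connected : Connected G
    connected u v = walk-to-root u ++ʷ reverseʷ (walk-to-root v)

    -- On a cycle, the vertex with the largest label would have two distinct
    -- neighbours on the cycle, both of them its parent.
    acyclic : ¬ Cycle G
    acyclic C with argmax (toℕ ∘ Cycle.c C)
    ... | top , maximal with cycle-neighbours G C top
    ...   | a , b , a≢b , top~a , top~b =
      a≢b (c-inj (toℕ-injective (trans (sym (is-parent a top~a)) (is-parent b top~b))))
      where
      open Cycle C
      is-parent : ∀ x → Adj G (c top) (c x) → parent (toℕ (c top)) ≡ toℕ (c x)
      is-parent x top~x = smaller-neighbour-is-parent top~x
        (≤∧≢⇒< (maximal x) (λ e → adj⇒≢ G top~x (sym (toℕ-injective e))))

    parentGraph-isTree : IsTree G
    parentGraph-isTree = s≤s z≤n , connected , acyclic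

∈⇒lookup : ∀ {n} {x : Fin n} {p : Subset n} → x ∈ p → lookup p x ≡ inside
∈⇒lookup = []=⇒lookup

lookup⇒∈ : ∀ {n} {x : Fin n} {p : Subset n} → lookup p x ≡ inside → x ∈ p
lookup⇒∈ {x = x} {p} = lookup⇒[]= x p

∈⇒1≤∣p∣ : ∀ {n} {x : Fin n} {p : Subset n} → x ∈ p → 1 ≤ ∣ p ∣
∈⇒1≤∣p∣ x∈p = ≤-trans (s≤s z≤n) (x∈p⇒∣p-x∣<∣p∣ x∈p)

two-members⇒2≤∣p∣ : ∀ {n} {x y : Fin n} {p : Subset n} → x ∈ p → y ∈ p → x ≢ y → 2 ≤ ∣ p ∣
two-members⇒2≤∣p∣ x∈p y∈p x≢y =
  ≤-trans (s≤s (∈⇒1≤∣p∣ (x∈p∧x≢y⇒x∈p-y y∈p (x≢y ∘ sym)))) (x∈p⇒∣p-x∣<∣p∣ x∈p)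

∣p++q∣ : ∀ {m n} (p : Subset m) (q : Subset n) → ∣ p ++ q ∣ ≡ ∣ p ∣ + ∣ q ∣
∣p++q∣ []            q = refl
∣p++q∣ (outside ∷ p) q = ∣p++q∣ p q
∣p++q∣ (inside  ∷ p) q = cong suc (∣p++q∣ p q)

data BlockView (k b : ℕ) : Fin (k * b) → Set where
  block : (i : Fin k) (r : Fin b) → BlockView k b (combine i r)

blockView : ∀ k b (v : Fin (k * b)) → BlockView k b v
blockView k b v = subst (BlockView k b) (combine-remQuot {k} b v)
                        (block (proj₁ (remQuot {k} b v)) (proj₂ (remQuot {k} b v)))

blockOf : ∀ {k b} → Subset (k * b) → Fin k → Subset b
blockOf {b = b} S i = tabulate (λ (r : Fin b) → lookup S (combine i r))

∈-blockOf : ∀ {k b} (S : Subset (k * b)) (i : Fin k) (r : Fin b) →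
            combine i r ∈ S → r ∈ blockOf S i
∈-blockOf S i r p =
  lookup⇒∈ (trans (lookup∘tabulate (λ r′ → lookup S (combine i r′)) r) (∈⇒lookup {p = S} p))

∣concat∣≥ : ∀ {k b m} (Bs : Vec (Subset b) k) →
            (∀ i → m ≤ ∣ lookup Bs i ∣) → k * m ≤ ∣ concat Bs ∣
∣concat∣≥ []       _ = z≤n
∣concat∣≥ (B ∷ Bs) h =
  subst (_ ≤_) (sym (∣p++q∣ B (concat Bs))) (+-mono-≤ (h Fin.zero) (∣concat∣≥ Bs (h ∘ Fin.suc)))

blockwise-lower-bound : ∀ k {b m} (S : Subset (k * b)) →
                        (∀ i → m ≤ ∣ blockOf S i ∣) → k * m ≤ ∣ S ∣
blockwise-lower-bound k {b} {m} S h with group k b S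
... | Bs , refl = ∣concat∣≥ Bs (λ i → subst (λ B → m ≤ ∣ B ∣) (block-is-lookup i) (h i))
  where
  block-is-lookup : ∀ i → blockOf (concat Bs) i ≡ lookup Bs i
  block-is-lookup i = trans (tabulate-cong (lookup-concat Bs i)) (tabulate∘lookup (lookup Bs i))

repeatBlock : ∀ k {b} → Subset b → Subset (k * b)
repeatBlock k B = concat (replicate k B)

lookup-repeatBlock : ∀ {k b} (B : Subset b) (i : Fin k) (r : Fin b) →
                     lookup (repeatBlock k B) (combine i r) ≡ lookup B r
lookup-repeatBlock {k} B i r =
  trans (lookup-concat (replicate k B) i r) (cong (λ B′ → lookup B′ r) (lookup-replicate i B))

∈-repeatBlock : ∀ {k b} (B : Subset b) (i : Fin k) (r : Fin b) →
                r ∈ B → combine i r ∈ repeatBlock k B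
∈-repeatBlock B i r r∈B = lookup⇒∈ (trans (lookup-repeatBlock B i r) (∈⇒lookup r∈B))

∈-repeatBlock⁻ : ∀ {k b} (B : Subset b) (i : Fin k) (r : Fin b) →
                 combine i r ∈ repeatBlock k B → r ∈ B
∈-repeatBlock⁻ B i r c∈S = lookup⇒∈ (trans (sym (lookup-repeatBlock B i r)) (∈⇒lookup c∈S))

∣repeatBlock∣ : ∀ k {b} (B : Subset b) → ∣ repeatBlock k B ∣ ≡ k * ∣ B ∣
∣repeatBlock∣ zero    B = refl
∣repeatBlock∣ (suc k) B =
  trans (∣p++q∣ B (repeatBlock k B)) (cong (∣ B ∣ +_) (∣repeatBlock∣ k B))

-- The caterpillar's parent function: vertex 3q + r + 1 (r < 3) has parent 3q,
-- i.e. leaves hang at the spine vertex of their block and spine vertex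
-- 3(q + 1) at the previous spine vertex 3q.
caterpillarParent : ℕ → ℕ
caterpillarParent t = (t ∸ 1) / 3 * 3

caterpillarParent-< : ∀ t → caterpillarParent (suc t) < suc t
caterpillarParent-< t = s≤s (m/n*n≤m t 3)

caterpillarParent-block : ∀ q r → r < 3 → caterpillarParent (3 * q + suc r) ≡ 3 * q
caterpillarParent-block q r r<3 = begin
  (3 * q + suc r ∸ 1) / 3 * 3  ≡⟨ cong (λ t → t / 3 * 3) (+-∸-assoc (3 * q) (s≤s z≤n)) ⟩
  (3 * q + r) / 3 * 3          ≡⟨ cong (_* 3) (+-distrib-/-∣ˡ r (m∣m*n q)) ⟩
  (3 * q / 3 + r / 3) * 3      ≡⟨ cong₂ (λ a b → (a + b) * 3) 3q/3≡q (m<n⇒m/n≡0 r<3) ⟩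
  (q + 0) * 3                  ≡⟨ cong (_* 3) (+-identityʳ q) ⟩
  q * 3                        ≡⟨ *-comm q 3 ⟩
  3 * q                        ∎
  where
  open ≡-Reasoning
  3q/3≡q : 3 * q / 3 ≡ q
  3q/3≡q = trans (cong (_/ 3) (*-comm 3 q)) (m*n/n≡m q 3)

open ParentTree caterpillarParent caterpillarParent-<

-- The caterpillar with spine x₀ … x_j, each x_i carrying two leaves; its
-- vertex set Fin (suc (2 + j * 3)) is Fin ((suc j) * 3).
caterpillar : ℕ → Graph
caterpillar j = parentGraph (2 + j * 3)

module Caterpillar (j : ℕ) where

  k : ℕ
  k = suc j

  G : Graph
  G = caterpillar j

  -- Block i consists of the spine vertex x_i (label 3i) and its two leaves.
  spine : Fin k → Vertex G
  spine i = combine i Fin.zero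

  leaf : Fin k → Fin 2 → Vertex G
  leaf i r = combine i (Fin.suc r)

  first second : Fin 2
  first  = Fin.zero
  second = Fin.suc Fin.zero

  data VertexView : Vertex G → Set where
    spine-view : ∀ i → VertexView (spine i)
    leaf-view  : ∀ i r → VertexView (leaf i r)

  view : ∀ v → VertexView v
  view v with blockView k 3 v
  ... | block i Fin.zero    = spine-view i
  ... | block i (Fin.suc r) = leaf-view i r

  spine-injective : ∀ i i′ → spine i ≡ spine i′ → i ≡ i′
  spine-injective i i′ = combine-injectiveˡ i Fin.zero i′ Fin.zero

  twin-leaves-differ : ∀ i → leaf i first ≢ leaf i second
  twin-leaves-differ i e with combine-injectiveʳ i (Fin.suc first) i (Fin.suc second) e
  ... | ()

  -- Labels of leaves are not multiples of three, so leaves have no children.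
  3∤leaf : ∀ i r → ¬ 3 ∣ toℕ (leaf i r)
  3∤leaf i r 3∣leaf = <⇒≱ (toℕ<n (Fin.suc r)) (∣⇒≤ (∣m+n∣m⇒∣n 3∣block (m∣m*n (toℕ i))))
    where
    3∣block : 3 ∣ 3 * toℕ i + suc (toℕ r)
    3∣block = subst (3 ∣_) (toℕ-combine i (Fin.suc r)) 3∣leaf

  leaf-pendant : ∀ i r → Pendant G (leaf i r) (spine i)
  leaf-pendant i r =
    childless-pendant (2 + j * 3) (leaf i r) (spine i) 0<leaf parent≡spine childless
    where
    open ≡-Reasoning
    0<leaf : 0 < toℕ (leaf i r)
    0<leaf = subst (0 <_) (sym (toℕ-combine i (Fin.suc r)))
                   (≤-trans (s≤s z≤n) (m≤n+m _ (3 * toℕ i)))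
    parent≡spine : caterpillarParent (toℕ (leaf i r)) ≡ toℕ (spine i)
    parent≡spine = begin
      caterpillarParent (toℕ (leaf i r))
        ≡⟨ cong caterpillarParent (toℕ-combine i (Fin.suc r)) ⟩
      caterpillarParent (3 * toℕ i + suc (toℕ r))
        ≡⟨ caterpillarParent-block (toℕ i) (toℕ r) (m<n⇒m<1+n (toℕ<n r)) ⟩
      3 * toℕ i                                   ≡⟨ sym (+-identityʳ (3 * toℕ i)) ⟩
      3 * toℕ i + 0                               ≡⟨ sym (toℕ-combine i Fin.zero) ⟩
      toℕ (spine i)                               ∎
    childless : ∀ t → 0 < t → caterpillarParent t ≢ toℕ (leaf i r)
    childless t _ p≡leaf = 3∤leaf i r (subst (3 ∣_) p≡leaf (n∣m*n ((t ∸ 1) / 3)))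

  spine~leaf : ∀ i r → Adj G (spine i) (leaf i r)
  spine~leaf i r = adj-sym′ G {leaf i r} {spine i} (attached (leaf-pendant i r))

  module _ (S : Subset (k * 3)) where

    -- Any set containing every first leaf is forcing: a first leaf forces
    -- its spine vertex, which then forces the second leaf.
    module _ (has-first : ∀ i → leaf i first ∈ S) where

      spine-colored : ∀ i → Colored G S (spine i)
      spine-colored i = pendant-forces (leaf-pendant i first) (initial (has-first i))

      -- Every neighbour of spine i other than its second leaf is colored,
      -- since second leaves of other blocks are not adjacent to spine i.
      others-colored : ∀ i w → Adj G (spine i) w → w ≢ leaf i second → Colored G S w
      others-colored i w i~w w≢leaf with view w
      ... | spine-view i′         = spine-colored i′
      ... | leaf-view i′ Fin.zero = initial (has-first i′)
      ... | leaf-view i′ (Fin.suc Fin.zero)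
        with spine-injective i i′
               (only (leaf-pendant i′ second) (spine i) (adj-sym′ G {spine i} i~w))
      ...   | refl = contradiction refl w≢leaf

      first-leaves-force : IsForcingSet G S
      first-leaves-force v with view v
      ... | spine-view i                   = spine-colored i
      ... | leaf-view i Fin.zero           = initial (has-first i)
      ... | leaf-view i (Fin.suc Fin.zero) =
        force (spine-colored i) (spine~leaf i second) (others-colored i)

    forcing-meets-block : IsForcingSet G S → ∀ i → ∃ λ r → leaf i r ∈ S
    forcing-meets-block forcing i
      with twin-pendants-meet (leaf-pendant i first) (leaf-pendant i second)
                              (twin-leaves-differ i) forcing
    ... | inj₁ first∈S  = first , first∈S
    ... | inj₂ second∈S = second , second∈S

    forcing-lower-bound : IsForcingSet G S → k * 1 ≤ ∣ S ∣
    forcing-lower-bound forcing = blockwise-lower-bound k S λ i →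
      let (r , leaf∈S) = forcing-meets-block forcing i
      in ∈⇒1≤∣p∣ (∈-blockOf S i (Fin.suc r) leaf∈S)

    -- A total forcing set moreover contains the spine vertex of each block.
    total-lower-bound : IsTotalForcingSet G S → k * 2 ≤ ∣ S ∣
    total-lower-bound (forcing , no-isolated) = blockwise-lower-bound k S λ i →
      let (r , leaf∈S) = forcing-meets-block forcing i
          spine∈S      = pendant-in-total (leaf-pendant i r) no-isolated leaf∈S
      in two-members⇒2≤∣p∣ (∈-blockOf S i Fin.zero spine∈S)
                           (∈-blockOf S i (Fin.suc r) leaf∈S) (λ ())

  firstLeafBlock spineAndFirstLeafBlock : Subset 3
  firstLeafBlock         = outside ∷ inside ∷ outside ∷ []
  spineAndFirstLeafBlock = inside  ∷ inside ∷ outside ∷ []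

  firstLeaves : Subset (k * 3)
  firstLeaves = repeatBlock k firstLeafBlock

  spinesAndFirstLeaves : Subset (k * 3)
  spinesAndFirstLeaves = repeatBlock k spineAndFirstLeafBlock

  firstLeaves-forcing : IsForcingSet G firstLeaves
  firstLeaves-forcing =
    first-leaves-force firstLeaves λ i → ∈-repeatBlock firstLeafBlock i (Fin.suc first) (there here)

  spinesAndFirstLeaves-total : IsTotalForcingSet G spinesAndFirstLeaves
  spinesAndFirstLeaves-total = first-leaves-force spinesAndFirstLeaves first∈S , no-isolated
    where
    first∈S : ∀ i → leaf i first ∈ spinesAndFirstLeaves
    first∈S i = ∈-repeatBlock spineAndFirstLeafBlock i (Fin.suc first) (there here)
    no-isolated : NoIsolatedIn G spinesAndFirstLeaves
    no-isolated v v∈S with view v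
    ... | spine-view i         = leaf i first , first∈S i , spine~leaf i first
    ... | leaf-view i Fin.zero =
      spine i , ∈-repeatBlock spineAndFirstLeafBlock i Fin.zero here ,
      attached (leaf-pendant i first)
    ... | leaf-view i (Fin.suc Fin.zero)
      with ∈-repeatBlock⁻ spineAndFirstLeafBlock i (Fin.suc second) v∈S
    ...   | there (there ())

  forcing-number : ForcingNumber G (k * 1)
  forcing-number =
    (firstLeaves , firstLeaves-forcing , ∣repeatBlock∣ k firstLeafBlock) , forcing-lower-bound

  total-forcing-number : TotalForcingNumber G (k * 2)
  total-forcing-number =
    (spinesAndFirstLeaves , spinesAndFirstLeaves-total , ∣repeatBlock∣ k spineAndFirstLeafBlock) ,
    total-lower-bound

proposition1 : ∀ (k : ℕ) → 1 ≤ k →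
    ∃ λ (T : Graph) → IsTree T × ∃ λ (f : ℕ) → ∃ λ (ft : ℕ) →
      ForcingNumber T f × TotalForcingNumber T ft × ft ≡ f + k
proposition1 (suc j) _ =
  caterpillar j , parentGraph-isTree (2 + j * 3) , k * 1 , k * 2 ,
  forcing-number , total-forcing-number , trans (*-suc k 1) (+-comm k (k * 1))
  where open Caterpillar j
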